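{- Let $A$ be a finite group, let $B$ be a subgroup of $A$ of index $2$, and let $\alpha$ be a non-identity automorphism of $A$ with $B^\alpha=B$. Then the number of subsets $S\subseteq A\setminus B$ with $S^\alpha=S$ is at most $2^{\frac{3|A|}{8}}$. -}

module Defs where

open import Data.Nat using (ℕ; zero; suc; _*_)
open import Data.Fin using (Fin; _≟_)
open import Data.Fin.Subset using (Subset; _∈_; _⊆_; ∁; ∣_∣; inside; outside)
open import Data.Fin.Subset.Properties using (_∈?_; _⊆?_)
open import Data.Fin.Properties using (all?; any?)
open import Data.Vec using (_∷_; [])
open import Data.List using (List; [_]; map; _++_; filter; length)
open import Data.Product using (Σ; _×_; _,_; ∃)
open import Data.Product.Relation.Binary.Pointwise.NonDependent using ()
open import Function using (_⇔_; Injective; Surjective)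
open import Function.Definitions using (Bijective)
open import Relation.Nullary using (Dec; ¬_)
open import Relation.Nullary.Decidable using (_×-dec_; _→-dec_)
open import Relation.Binary.PropositionalEquality using (_≡_)
open import Algebra.Core using (Op₁; Op₂)
open import Algebra.Structures using (IsGroup)

-- A finite group, presented (up to isomorphism) on the carrier Fin order,
-- with propositional equality.
record FiniteGroup : Set where
  field
    order : ℕ
    _∙_   : Op₂ (Fin order)
    ε     : Fin order
    _⁻¹   : Op₁ (Fin order)
    isGroup : IsGroup _≡_ _∙_ ε _⁻¹

module _ (G : FiniteGroup) where
  open FiniteGroup G

  record IsSubgroup (B : Subset order) : Set where
    field
      ε∈B   : ε ∈ B
      ∙-closed : ∀ {x y} → x ∈ B → y ∈ B → (x ∙ y) ∈ B
      ⁻¹-closed : ∀ {x} → x ∈ B → (x ⁻¹) ∈ B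

  HasIndex2 : Subset order → Set
  HasIndex2 B = order ≡ 2 * ∣ B ∣

  record IsAutomorphism (α : Fin order → Fin order) : Set where
    field
      bijective : Bijective _≡_ _≡_ α
      homo      : ∀ x y → α (x ∙ y) ≡ α x ∙ α y

  NonIdentity : (Fin order → Fin order) → Set
  NonIdentity α = ¬ (∀ x → α x ≡ x)

ImageInvariant : ∀ {n} → (Fin n → Fin n) → Subset n → Set
ImageInvariant α S = ∀ y → (y ∈ S → ∃ λ x → x ∈ S × α x ≡ y)
                         × ((∃ λ x → x ∈ S × α x ≡ y) → y ∈ S)

imageInvariant? : ∀ {n} (α : Fin n → Fin n) (S : Subset n) → Dec (ImageInvariant α S)
imageInvariant? α S = all? λ y →
  ((y ∈? S) →-dec any? (λ x → (x ∈? S) ×-dec (α x ≟ y)))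
  ×-dec (any? (λ x → (x ∈? S) ×-dec (α x ≟ y)) →-dec (y ∈? S))

allSubsets : ∀ n → List (Subset n)
allSubsets zero    = [ [] ]
allSubsets (suc n) = map (inside ∷_) (allSubsets n) ++ map (outside ∷_) (allSubsets n)

Good : ∀ {n} → Subset n → (Fin n → Fin n) → Subset n → Set
Good B α S = S ⊆ ∁ B × ImageInvariant α S

good? : ∀ {n} (B : Subset n) (α : Fin n → Fin n) (S : Subset n) → Dec (Good B α S)
good? B α S = (S ⊆? ∁ B) ×-dec imageInvariant? α S

countGood : ∀ {n} → Subset n → (Fin n → Fin n) → ℕ
countGood {n} B α = length (filter (good? B α) (allSubsets n))

-- Let C = A ∖ B and F the set of points of C fixed by α. An α-invariant set is
-- determined by its points x with ¬ α x < x (follow α downwards from any other point),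
-- and also by its points with α x < x or α x ≡ x (follow α upwards). So a pair (S , T)
-- of α-invariant subsets of C is determined by the subset of C agreeing with T where
-- α x < x and with S elsewhere, together with T ∩ F; hence N² ≤ 2^(|C| + |F|) for the
-- number N of such sets. If α moves some z ∈ B, then y ↦ z y maps F injectively to
-- points of C moved by α, so 2|F| ≤ |C|. Otherwise α fixes B pointwise, and as C = xB
-- for every x ∈ C, a fixed point in C would force α = id; so F is empty. With
-- |A| = 2|C| this gives N⁸ ≤ 2^(4|C| + 4|F|) ≤ 2^(6|C|) = 2^(3|A|).

module Submission where

open import Defs
open import Algebra.Bundles using (Group)
import Algebra.Properties.Group as GroupProperties
open import Data.Bool using (true; false)
open import Data.Empty using (⊥)
open import Data.Fin using (Fin; zero; suc; _<_; _>_; _≟_)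
open import Data.Fin.Induction using (<-wellFounded; >-wellFounded)
open import Data.Fin.Properties using (_<?_; <-cmp; any?; ¬∀⟶∃¬)
open import Data.Fin.Subset using (Subset; _∈_; _∉_; _⊆_; ∁; _∩_; ∣_∣; Empty; inside; outside)
open import Data.Fin.Subset.Properties
  using (_∈?_; drop-∷-⊆; ⊆-antisym; x∈p∩q⁺; x∈p∩q⁻; x∈∁p⇒x∉p; x∉p⇒x∈∁p; ∣∁p∣≡n∸∣p∣; Empty-unique; ∣⊥∣≡0)
open import Data.List using (List; []; _∷_; [_]; length; map; _++_; filter; allFin; cartesianProduct; tabulate)
open import Data.List.Properties using (length-++; length-map; length-removeAt′)
open import Data.List.Membership.Propositional using (_─_) renaming (_∈_ to _∈ₗ_)
open import Data.List.Membership.Propositional.Properties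
  using (∈-map⁺; ∈-map⁻; ∈-++⁺ˡ; ∈-++⁺ʳ; ∈-++⁻; ∈-filter⁺; ∈-filter⁻; ∈-allFin; ∈-cartesianProduct⁺; ∈-cartesianProduct⁻)
open import Data.List.Relation.Unary.Any using (here; there; index)
open import Data.List.Relation.Unary.All using (All; []; lookup)
open import Data.List.Relation.Unary.All.Properties using (¬Any⇒All¬)
open import Data.List.Relation.Unary.AllPairs using ([]; _∷_)
open import Data.List.Relation.Unary.Unique.Propositional using (Unique)
import Data.List.Relation.Unary.Unique.Propositional.Properties as Unique
open import Data.Nat using (zero; suc; _+_; _*_; _^_; _∸_; _≤_; z≤n; s≤s)
open import Data.Nat.Properties
  using (module ≤-Reasoning; +-identityʳ; *-identityʳ; m+n∸m≡n; <-irrefl; +-monoʳ-≤; *-monoˡ-≤; ^-monoˡ-≤; ^-monoʳ-≤; ^-distribˡ-+-*; ^-*-assoc)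
open import Data.Nat.Tactic.RingSolver using (solve-∀)
open import Data.Product using (_×_; _,_; proj₁; proj₂)
open import Data.Sum using (_⊎_; inj₁; inj₂)
open import Data.Vec as Vec using ([]; _∷_; here; there)
open import Data.Vec.Properties using (∷-injectiveʳ)
open import Function using (Injective; case_of_)
open import Induction.WellFounded using (WellFounded; Acc; acc)
open import Level using (0ℓ)
open import Relation.Binary using (Rel; tri<; tri≈; tri>)
open import Relation.Binary.PropositionalEquality using (_≡_; _≢_; refl; sym; trans; cong; cong₂; subst; module ≡-Reasoning)
open import Relation.Nullary using (¬_; yes; no; does; contradiction)
open import Relation.Nullary.Decidable using (_×-dec_; _⊎-dec_; ¬?; decidable-stable)
open import Relation.Unary using (Pred; Decidable)

module _ {A : Set} where

  ∈-─ : ∀ {x z : A} {ys} (x∈ys : x ∈ₗ ys) → z ∈ₗ ys → z ≢ x → z ∈ₗ ys ─ x∈ys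
  ∈-─ (here refl)  (here refl)  z≢x = contradiction refl z≢x
  ∈-─ (here _)     (there z∈ys) _   = z∈ys
  ∈-─ (there _)    (here refl)  _   = here refl
  ∈-─ (there x∈ys) (there z∈ys) z≢x = there (∈-─ x∈ys z∈ys z≢x)

module _ {A B : Set} (f : A → B) where

  injectiveOn⇒length≤ : ∀ {xs ys} → Unique xs → (∀ {x} → x ∈ₗ xs → f x ∈ₗ ys) →
                        (∀ {x y} → x ∈ₗ xs → y ∈ₗ xs → f x ≡ f y → x ≡ y) →
                        length xs ≤ length ys
  injectiveOn⇒length≤ {[]}     _              _    _   = z≤n
  injectiveOn⇒length≤ {x ∷ xs} {ys} (x∉xs ∷ xs-unique) into inj = begin
    suc (length xs)            ≤⟨ s≤s (injectiveOn⇒length≤ xs-unique into′ inj′) ⟩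
    suc (length (ys ─ fx∈ys))  ≡⟨ length-removeAt′ ys (index fx∈ys) ⟨
    length ys                  ∎
    where
    open ≤-Reasoning
    fx∈ys = into (here refl)
    into′ : ∀ {y} → y ∈ₗ xs → f y ∈ₗ ys ─ fx∈ys
    into′ y∈xs = ∈-─ fx∈ys (into (there y∈xs))
                     (λ fy≡fx → lookup x∉xs y∈xs (sym (inj (there y∈xs) (here refl) fy≡fx)))
    inj′ : ∀ {y z} → y ∈ₗ xs → z ∈ₗ xs → f y ≡ f z → y ≡ z
    inj′ y∈xs z∈xs = inj (there y∈xs) (there z∈xs)

⊆⇒length≤ : ∀ {A : Set} {xs ys : List A} → Unique xs → (∀ {x} → x ∈ₗ xs → x ∈ₗ ys) →
            length xs ≤ length ys
⊆⇒length≤ xs-unique xs⊆ys = injectiveOn⇒length≤ (λ x → x) xs-unique xs⊆ys (λ _ _ x≡y → x≡y)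

length-cartesianProduct : ∀ {A B : Set} (xs : List A) (ys : List B) →
                          length (cartesianProduct xs ys) ≡ length xs * length ys
length-cartesianProduct []       ys = refl
length-cartesianProduct (x ∷ xs) ys = begin
  length (map (x ,_) ys ++ cartesianProduct xs ys)          ≡⟨ length-++ (map (x ,_) ys) ⟩
  length (map (x ,_) ys) + length (cartesianProduct xs ys)  ≡⟨ cong₂ _+_ (length-map (x ,_) ys)
                                                                          (length-cartesianProduct xs ys) ⟩
  length ys + length xs * length ys                         ∎
  where open ≡-Reasoning

subset : ∀ {n} {P : Pred (Fin n) 0ℓ} → Decidable P → Subset n
subset P? = Vec.tabulate (λ x → does (P? x))

∈-subset⁺ : ∀ {n} {P : Pred (Fin n) 0ℓ} (P? : Decidable P) {x} → P x → x ∈ subset P?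
∈-subset⁺ P? {zero} Px with P? zero
... | yes _   = here
... | no ¬Px = contradiction Px ¬Px
∈-subset⁺ P? {suc x} Px = there (∈-subset⁺ (λ y → P? (suc y)) Px)

∈-subset⁻ : ∀ {n} {P : Pred (Fin n) 0ℓ} (P? : Decidable P) {x} → x ∈ subset P? → P x
∈-subset⁻ P? {zero} x∈ with P? zero | x∈
... | yes Px | _ = Px
... | no _   | ()
∈-subset⁻ P? {suc x} (there x∈) = ∈-subset⁻ (λ y → P? (suc y)) x∈

∩-monoˡ-⊆ : ∀ {n} {p q r : Subset n} → p ⊆ q → p ∩ r ⊆ q ∩ r
∩-monoˡ-⊆ {p = p} {r = r} p⊆q x∈p∩r with x∈p∩q⁻ p r x∈p∩r
... | x∈p , x∈r = x∈p∩q⁺ (p⊆q x∈p , x∈r)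

members : ∀ {n} → Subset n → List (Fin n)
members {n} p = filter (_∈? p) (allFin n)

members-unique : ∀ {n} (p : Subset n) → Unique (members p)
members-unique {n} p = Unique.filter⁺ (_∈? p) (Unique.allFin⁺ n)

∈-members⁺ : ∀ {n} {p : Subset n} {x} → x ∈ p → x ∈ₗ members p
∈-members⁺ {p = p} {x} x∈p = ∈-filter⁺ (_∈? p) (∈-allFin x) x∈p

∈-members⁻ : ∀ {n} {p : Subset n} {x} → x ∈ₗ members p → x ∈ p
∈-members⁻ {n} {p} x∈ = proj₂ (∈-filter⁻ (_∈? p) {xs = allFin n} x∈)

-- Stated for tabulate because allFin (suc n) reduces to zero ∷ tabulate suc.
length-filter-∈?-suc : ∀ {m n} b (p : Subset n) (g : Fin m → Fin n) →
                       length (filter (_∈? b ∷ p) (tabulate (λ i → suc (g i)))) ≡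
                       length (filter (_∈? p) (tabulate g))
length-filter-∈?-suc {zero}  b p g = refl
length-filter-∈?-suc {suc m} b p g with does (g zero ∈? p)
... | true  = cong suc (length-filter-∈?-suc b p (λ i → g (suc i)))
... | false = length-filter-∈?-suc b p (λ i → g (suc i))

length-members : ∀ {n} (p : Subset n) → length (members p) ≡ ∣ p ∣
length-members []            = refl
length-members (inside ∷ p)  = cong suc (trans (length-filter-∈?-suc inside p (λ i → i)) (length-members p))
length-members (outside ∷ p) = trans (length-filter-∈?-suc outside p (λ i → i)) (length-members p)

subsetsOf : ∀ {n} → Subset n → List (Subset n)
subsetsOf []            = [ [] ]
subsetsOf (inside ∷ p)  = map (inside ∷_) (subsetsOf p) ++ map (outside ∷_) (subsetsOf p)
subsetsOf (outside ∷ p) = map (outside ∷_) (subsetsOf p)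

length-subsetsOf : ∀ {n} (p : Subset n) → length (subsetsOf p) ≡ 2 ^ ∣ p ∣
length-subsetsOf [] = refl
length-subsetsOf (inside ∷ p) = begin
  length (map (inside ∷_) (subsetsOf p) ++ map (outside ∷_) (subsetsOf p))
    ≡⟨ length-++ (map (inside ∷_) (subsetsOf p)) ⟩
  length (map (inside ∷_) (subsetsOf p)) + length (map (outside ∷_) (subsetsOf p))
    ≡⟨ cong₂ _+_ (length-map _ (subsetsOf p)) (length-map _ (subsetsOf p)) ⟩
  length (subsetsOf p) + length (subsetsOf p)
    ≡⟨ cong₂ _+_ (length-subsetsOf p) (trans (length-subsetsOf p) (sym (+-identityʳ _))) ⟩
  2 ^ ∣ p ∣ + (2 ^ ∣ p ∣ + 0)
    ∎
  where open ≡-Reasoning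
length-subsetsOf (outside ∷ p) = trans (length-map _ (subsetsOf p)) (length-subsetsOf p)

∈-subsetsOf : ∀ {n} {q p : Subset n} → q ⊆ p → q ∈ₗ subsetsOf p
∈-subsetsOf {q = []}          {[]}          _ = here refl
∈-subsetsOf {q = inside ∷ q}  {inside ∷ p}  q⊆p =
  ∈-++⁺ˡ (∈-map⁺ (inside ∷_) (∈-subsetsOf (drop-∷-⊆ q⊆p)))
∈-subsetsOf {q = outside ∷ q} {inside ∷ p}  q⊆p =
  ∈-++⁺ʳ (map (inside ∷_) (subsetsOf p)) (∈-map⁺ (outside ∷_) (∈-subsetsOf (drop-∷-⊆ q⊆p)))
∈-subsetsOf {q = inside ∷ q}  {outside ∷ p} q⊆p with () ← q⊆p here
∈-subsetsOf {q = outside ∷ q} {outside ∷ p} q⊆p =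
  ∈-map⁺ (outside ∷_) (∈-subsetsOf (drop-∷-⊆ q⊆p))

allSubsets-unique : ∀ n → Unique (allSubsets n)
allSubsets-unique 0       = [] ∷ []
allSubsets-unique (suc n) =
  Unique.++⁺ (Unique.map⁺ ∷-injectiveʳ (allSubsets-unique n)) (Unique.map⁺ ∷-injectiveʳ (allSubsets-unique n)) disjoint
  where
  disjoint : ∀ {p} → p ∈ₗ map (inside ∷_) (allSubsets n) × p ∈ₗ map (outside ∷_) (allSubsets n) → ⊥
  disjoint (p∈ , q∈) with ∈-map⁻ (inside ∷_) p∈ | ∈-map⁻ (outside ∷_) q∈
  ... | _ , _ , refl | _ , _ , ()

module _ {A : Set} {_≺_ : Rel A 0ℓ} (≺-wellFounded : WellFounded _≺_) (f : A → A)
         {D : Pred A 0ℓ} (descends : ∀ x → D x ⊎ f x ≺ x) {P Q : Pred A 0ℓ}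
         (P-closed : ∀ {x} → P x → P (f x)) (Q-closed : ∀ {x} → Q (f x) → Q x)
         (agree : ∀ {x} → D x → P x → Q x) where

  invariant-⊆ : ∀ {x} → P x → Q x
  invariant-⊆ {x} = go x (≺-wellFounded x)
    where
    go : ∀ x → Acc _≺_ x → P x → Q x
    go x (acc rs) Px with descends x
    ... | inj₁ Dx   = agree Dx Px
    ... | inj₂ fx≺x = Q-closed (go (f x) (rs fx≺x) (P-closed Px))

module _ {n} {α : Fin n → Fin n} {S : Subset n} (S-invariant : ImageInvariant α S) where

  imageInvariant⇒∈-α : ∀ {x} → x ∈ S → α x ∈ S
  imageInvariant⇒∈-α {x} x∈S = proj₂ (S-invariant (α x)) (x , x∈S , refl)

  imageInvariant⇒∈-α⁻ : Injective _≡_ _≡_ α → ∀ {x} → α x ∈ S → x ∈ S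
  imageInvariant⇒∈-α⁻ α-injective {x} αx∈S with proj₁ (S-invariant (α x)) αx∈S
  ... | y , y∈S , αy≡αx = subst (_∈ S) (α-injective αy≡αx) y∈S

module _ {n} (α : Fin n → Fin n) where

  fixed? : Decidable (λ x → α x ≡ x)
  fixed? x = α x ≟ x

  fixedPoints : Subset n
  fixedPoints = subset fixed?

  Merge : Subset n → Subset n → Pred (Fin n) 0ℓ
  Merge S T x = (α x < x × x ∈ T) ⊎ (¬ α x < x × x ∈ S)

  merge? : ∀ S T → Decidable (Merge S T)
  merge? S T x = (α x <? x ×-dec x ∈? T) ⊎-dec (¬? (α x <? x) ×-dec x ∈? S)

  merge : Subset n → Subset n → Subset n
  merge S T = subset (merge? S T)

  merge-⊆ : ∀ {S T U} → S ⊆ U → T ⊆ U → merge S T ⊆ U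
  merge-⊆ {S} {T} S⊆U T⊆U x∈merge with ∈-subset⁻ (merge? S T) x∈merge
  ... | inj₁ (_ , x∈T) = T⊆U x∈T
  ... | inj₂ (_ , x∈S) = S⊆U x∈S

module _ {n} {α : Fin n → Fin n} (α-injective : Injective _≡_ _≡_ α) {S T S′ T′ : Subset n}
         (merge≡ : merge α S T ≡ merge α S′ T′) where

  merge-≡⇒⊆ˡ : ImageInvariant α S → ImageInvariant α S′ → S ⊆ S′
  merge-≡⇒⊆ˡ S-invariant S′-invariant = invariant-⊆ <-wellFounded α descends
    (imageInvariant⇒∈-α S-invariant) (imageInvariant⇒∈-α⁻ S′-invariant α-injective) agree
    where
    descends : ∀ x → ¬ α x < x ⊎ α x < x
    descends x with α x <? x
    ... | yes αx<x = inj₂ αx<x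
    ... | no  αx≮x = inj₁ αx≮x
    agree : ∀ {x} → ¬ α x < x → x ∈ S → x ∈ S′
    agree αx≮x x∈S with ∈-subset⁻ (merge? α S′ T′) (subst (_ ∈_) merge≡ (∈-subset⁺ (merge? α S T) (inj₂ (αx≮x , x∈S))))
    ... | inj₁ (αx<x , _) = contradiction αx<x αx≮x
    ... | inj₂ (_ , x∈S′) = x∈S′

  merge-≡⇒⊆ʳ : T ∩ fixedPoints α ≡ T′ ∩ fixedPoints α → ImageInvariant α T → ImageInvariant α T′ → T ⊆ T′
  merge-≡⇒⊆ʳ fixed≡ T-invariant T′-invariant = invariant-⊆ >-wellFounded α descends
    (imageInvariant⇒∈-α T-invariant) (imageInvariant⇒∈-α⁻ T′-invariant α-injective) agree
    where
    descends : ∀ x → (α x < x ⊎ α x ≡ x) ⊎ α x > x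
    descends x with <-cmp (α x) x
    ... | tri< αx<x _ _ = inj₁ (inj₁ αx<x)
    ... | tri≈ _ αx≡x _ = inj₁ (inj₂ αx≡x)
    ... | tri> _ _ αx>x = inj₂ αx>x
    agree : ∀ {x} → α x < x ⊎ α x ≡ x → x ∈ T → x ∈ T′
    agree (inj₁ αx<x) x∈T with ∈-subset⁻ (merge? α S′ T′) (subst (_ ∈_) merge≡ (∈-subset⁺ (merge? α S T) (inj₁ (αx<x , x∈T))))
    ... | inj₁ (_ , x∈T′) = x∈T′
    ... | inj₂ (αx≮x , _) = contradiction αx<x αx≮x
    agree (inj₂ αx≡x) x∈T =
      proj₁ (x∈p∩q⁻ T′ _ (subst (_ ∈_) fixed≡ (x∈p∩q⁺ (x∈T , ∈-subset⁺ (fixed? α) αx≡x))))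

module _ {n} {α : Fin n → Fin n} (α-injective : Injective _≡_ _≡_ α) {S T S′ T′ : Subset n}
         (S-invariant : ImageInvariant α S) (T-invariant : ImageInvariant α T)
         (S′-invariant : ImageInvariant α S′) (T′-invariant : ImageInvariant α T′) where

  merge-injective : merge α S T ≡ merge α S′ T′ → T ∩ fixedPoints α ≡ T′ ∩ fixedPoints α →
                    S ≡ S′ × T ≡ T′
  merge-injective merge≡ fixed≡ =
      ⊆-antisym (merge-≡⇒⊆ˡ α-injective merge≡ S-invariant S′-invariant)
                (merge-≡⇒⊆ˡ α-injective (sym merge≡) S′-invariant S-invariant)
    , ⊆-antisym (merge-≡⇒⊆ʳ α-injective merge≡ fixed≡ T-invariant T′-invariant)
                (merge-≡⇒⊆ʳ α-injective (sym merge≡) (sym fixed≡) T′-invariant T-invariant)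

countGood*countGood≤ : ∀ {n} (B : Subset n) {α : Fin n → Fin n} → Injective _≡_ _≡_ α →
                       countGood B α * countGood B α ≤ 2 ^ ∣ ∁ B ∣ * 2 ^ ∣ ∁ B ∩ fixedPoints α ∣
countGood*countGood≤ {n} B {α} α-injective = begin
  length goods * length goods
    ≡⟨ length-cartesianProduct goods goods ⟨
  length (cartesianProduct goods goods)
    ≤⟨ injectiveOn⇒length≤ encode (Unique.cartesianProduct⁺ goods-unique goods-unique) encode-∈ encode-injective ⟩
  length (cartesianProduct (subsetsOf (∁ B)) (subsetsOf (∁ B ∩ fixedPoints α)))
    ≡⟨ length-cartesianProduct (subsetsOf (∁ B)) (subsetsOf (∁ B ∩ fixedPoints α)) ⟩
  length (subsetsOf (∁ B)) * length (subsetsOf (∁ B ∩ fixedPoints α))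
    ≡⟨ cong₂ _*_ (length-subsetsOf (∁ B)) (length-subsetsOf (∁ B ∩ fixedPoints α)) ⟩
  2 ^ ∣ ∁ B ∣ * 2 ^ ∣ ∁ B ∩ fixedPoints α ∣
    ∎
  where
  open ≤-Reasoning
  goods : List (Subset n)
  goods = filter (good? B α) (allSubsets n)
  goods-unique : Unique goods
  goods-unique = Unique.filter⁺ (good? B α) (allSubsets-unique n)
  good : ∀ {S} → S ∈ₗ goods → Good B α S
  good S∈ = proj₂ (∈-filter⁻ (good? B α) {xs = allSubsets n} S∈)
  encode : Subset n × Subset n → Subset n × Subset n
  encode (S , T) = merge α S T , T ∩ fixedPoints α
  encode-∈ : ∀ {ST} → ST ∈ₗ cartesianProduct goods goods →
             encode ST ∈ₗ cartesianProduct (subsetsOf (∁ B)) (subsetsOf (∁ B ∩ fixedPoints α))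
  encode-∈ {S , T} ST∈ with ∈-cartesianProduct⁻ goods goods ST∈
  ... | S∈ , T∈ = ∈-cartesianProduct⁺ (∈-subsetsOf (merge-⊆ α (proj₁ (good S∈)) (proj₁ (good T∈))))
                                      (∈-subsetsOf (∩-monoˡ-⊆ (proj₁ (good T∈))))
  encode-injective : ∀ {ST ST′} → ST ∈ₗ cartesianProduct goods goods → ST′ ∈ₗ cartesianProduct goods goods →
                     encode ST ≡ encode ST′ → ST ≡ ST′
  encode-injective {S , T} {S′ , T′} ST∈ ST′∈ encode≡
    with ∈-cartesianProduct⁻ goods goods ST∈ | ∈-cartesianProduct⁻ goods goods ST′∈
  ... | S∈ , T∈ | S′∈ , T′∈
    with merge-injective α-injective (proj₂ (good S∈)) (proj₂ (good T∈)) (proj₂ (good S′∈)) (proj₂ (good T′∈))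
                         (cong proj₁ encode≡) (cong proj₂ encode≡)
  ... | refl , refl = refl

module _ (G : FiniteGroup) where
  open FiniteGroup G

  group : Group 0ℓ 0ℓ
  group = record { Carrier = Fin order ; _≈_ = _≡_ ; _∙_ = _∙_ ; ε = ε ; _⁻¹ = _⁻¹ ; isGroup = isGroup }

  open GroupProperties group using (∙-cancelˡ; ∙-cancelʳ; \\-leftDividesˡ; \\-leftDividesʳ; //-rightDividesʳ)

  module _ {B : Subset order} (B-subgroup : IsSubgroup G B) where
    open IsSubgroup B-subgroup

    ∈∙∉⇒∉ : ∀ {b x} → b ∈ B → x ∉ B → b ∙ x ∉ B
    ∈∙∉⇒∉ {b} {x} b∈B x∉B bx∈B = x∉B (subst (_∈ B) (\\-leftDividesʳ b x) (∙-closed (⁻¹-closed b∈B) bx∈B))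

    ∉∙∈⇒∉ : ∀ {x b} → x ∉ B → b ∈ B → x ∙ b ∉ B
    ∉∙∈⇒∉ {x} {b} x∉B b∈B xb∈B = x∉B (subst (_∈ B) (//-rightDividesʳ b x) (∙-closed xb∈B (⁻¹-closed b∈B)))

    module _ (B-index2 : HasIndex2 G B) where

      ∣∁B∣≡∣B∣ : ∣ ∁ B ∣ ≡ ∣ B ∣
      ∣∁B∣≡∣B∣ = begin
        ∣ ∁ B ∣                      ≡⟨ ∣∁p∣≡n∸∣p∣ B ⟩
        order ∸ ∣ B ∣                ≡⟨ cong (_∸ ∣ B ∣) B-index2 ⟩
        ∣ B ∣ + (∣ B ∣ + 0) ∸ ∣ B ∣  ≡⟨ m+n∸m≡n ∣ B ∣ _ ⟩
        ∣ B ∣ + 0                    ≡⟨ +-identityʳ ∣ B ∣ ⟩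
        ∣ B ∣                        ∎
        where open ≡-Reasoning

      ∉∧∉⇒⁻¹∙∈ : ∀ {x y} → x ∉ B → y ∉ B → (x ⁻¹) ∙ y ∈ B
      ∉∧∉⇒⁻¹∙∈ {x} {y} x∉B y∉B = decidable-stable ((x ⁻¹) ∙ y ∈? B) λ x⁻¹y∉B → <-irrefl refl (begin-strict
        ∣ B ∣                            ≡⟨ trans (length-map (x ∙_) (members B)) (length-members B) ⟨
        length (map (x ∙_) (members B))  <⟨ ⊆⇒length≤ (y∉xB x⁻¹y∉B ∷ xB-unique) y∷xB⊆∁B ⟩
        length (members (∁ B))           ≡⟨ trans (length-members (∁ B)) ∣∁B∣≡∣B∣ ⟩
        ∣ B ∣                            ∎)
        where
        open ≤-Reasoning
        xB-unique : Unique (map (x ∙_) (members B))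
        xB-unique = Unique.map⁺ (∙-cancelˡ x _ _) (members-unique B)
        y∉xB : (x ⁻¹) ∙ y ∉ B → All (y ≢_) (map (x ∙_) (members B))
        y∉xB x⁻¹y∉B = ¬Any⇒All¬ _ λ y∈xB → case ∈-map⁻ (x ∙_) y∈xB of λ where
          (b , b∈B , refl) → x⁻¹y∉B (subst (_∈ B) (sym (\\-leftDividesʳ x b)) (∈-members⁻ b∈B))
        y∷xB⊆∁B : ∀ {z} → z ∈ₗ y ∷ map (x ∙_) (members B) → z ∈ₗ members (∁ B)
        y∷xB⊆∁B (here refl) = ∈-members⁺ (x∉p⇒x∈∁p y∉B)
        y∷xB⊆∁B (there z∈xB) with ∈-map⁻ (x ∙_) z∈xB
        ... | b , b∈B , refl = ∈-members⁺ (x∉p⇒x∈∁p (∉∙∈⇒∉ x∉B (∈-members⁻ b∈B)))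

  module _ {α : Fin order → Fin order} (α-homo : ∀ x y → α (x ∙ y) ≡ α x ∙ α y) where

    moved∙fixed-moved : ∀ {z y} → α z ≢ z → α y ≡ y → α (z ∙ y) ≢ z ∙ y
    moved∙fixed-moved {z} {y} αz≢z αy≡y αzy≡zy = αz≢z (∙-cancelʳ y (α z) z (begin
      α z ∙ y      ≡⟨ cong (α z ∙_) αy≡y ⟨
      α z ∙ α y    ≡⟨ α-homo z y ⟨
      α (z ∙ y)    ≡⟨ αzy≡zy ⟩
      z ∙ y        ∎))
      where open ≡-Reasoning

    module _ {B : Subset order} (B-subgroup : IsSubgroup G B) where

      moved∈B⇒∣∁B∩fixed∣+∣∁B∩fixed∣≤∣∁B∣ : ∀ {z} → z ∈ B → α z ≢ z →
        ∣ ∁ B ∩ fixedPoints α ∣ + ∣ ∁ B ∩ fixedPoints α ∣ ≤ ∣ ∁ B ∣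
      moved∈B⇒∣∁B∩fixed∣+∣∁B∩fixed∣≤∣∁B∣ {z} z∈B αz≢z = begin
        ∣ F ∣ + ∣ F ∣                                          ≡⟨ cong₂ _+_ (length-members F) zF-length ⟨
        length (members F) + length (map (z ∙_) (members F))  ≡⟨ length-++ (members F) ⟨
        length (members F ++ map (z ∙_) (members F))          ≤⟨ ⊆⇒length≤ F++zF-unique F++zF⊆∁B ⟩
        length (members (∁ B))                                ≡⟨ length-members (∁ B) ⟩
        ∣ ∁ B ∣                                               ∎
        where
        open ≤-Reasoning
        F = ∁ B ∩ fixedPoints α
        zF-length : length (map (z ∙_) (members F)) ≡ ∣ F ∣
        zF-length = trans (length-map (z ∙_) (members F)) (length-members F)
        fixed : ∀ {x} → x ∈ₗ members F → α x ≡ x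
        fixed x∈F = ∈-subset⁻ (fixed? α) (proj₂ (x∈p∩q⁻ (∁ B) _ (∈-members⁻ x∈F)))
        outside-B : ∀ {x} → x ∈ₗ members F → x ∉ B
        outside-B x∈F = x∈∁p⇒x∉p (proj₁ (x∈p∩q⁻ (∁ B) _ (∈-members⁻ x∈F)))
        F++zF-unique : Unique (members F ++ map (z ∙_) (members F))
        F++zF-unique = Unique.++⁺ (members-unique F) (Unique.map⁺ (∙-cancelˡ z _ _) (members-unique F)) λ where
          (x∈F , x∈zF) → case ∈-map⁻ (z ∙_) x∈zF of λ where
            (y , y∈F , refl) → moved∙fixed-moved αz≢z (fixed y∈F) (fixed x∈F)
        F++zF⊆∁B : ∀ {x} → x ∈ₗ members F ++ map (z ∙_) (members F) → x ∈ₗ members (∁ B)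
        F++zF⊆∁B x∈ with ∈-++⁻ (members F) x∈
        ... | inj₁ x∈F = ∈-members⁺ (x∉p⇒x∈∁p (outside-B x∈F))
        ... | inj₂ x∈zF with ∈-map⁻ (z ∙_) x∈zF
        ...   | y , y∈F , refl = ∈-members⁺ (x∉p⇒x∈∁p (∈∙∉⇒∉ B-subgroup z∈B (outside-B y∈F)))

      module _ (B-index2 : HasIndex2 G B) (α-nonIdentity : NonIdentity G α) where

        fixes-B⇒∣∁B∩fixed∣≡0 : (∀ {b} → b ∈ B → α b ≡ b) → ∣ ∁ B ∩ fixedPoints α ∣ ≡ 0
        fixes-B⇒∣∁B∩fixed∣≡0 fixes-B = trans (cong ∣_∣ (Empty-unique no-fixed-outside)) (∣⊥∣≡0 order)
          where
          moved = ¬∀⟶∃¬ order (λ x → α x ≡ x) (fixed? α) α-nonIdentity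
          w = proj₁ moved
          αw≢w = proj₂ moved
          no-fixed-outside : Empty (∁ B ∩ fixedPoints α)
          no-fixed-outside (x , x∈F) = αw≢w (begin
            α w                    ≡⟨ cong α (\\-leftDividesˡ x w) ⟨
            α (x ∙ ((x ⁻¹) ∙ w))   ≡⟨ α-homo x ((x ⁻¹) ∙ w) ⟩
            α x ∙ α ((x ⁻¹) ∙ w)   ≡⟨ cong₂ _∙_ αx≡x (fixes-B x⁻¹w∈B) ⟩
            x ∙ ((x ⁻¹) ∙ w)       ≡⟨ \\-leftDividesˡ x w ⟩
            w                      ∎)
            where
            open ≡-Reasoning
            x∉B = x∈∁p⇒x∉p (proj₁ (x∈p∩q⁻ (∁ B) _ x∈F))
            αx≡x = ∈-subset⁻ (fixed? α) (proj₂ (x∈p∩q⁻ (∁ B) _ x∈F))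
            x⁻¹w∈B = ∉∧∉⇒⁻¹∙∈ B-subgroup B-index2 x∉B (λ w∈B → αw≢w (fixes-B w∈B))

        ∣∁B∩fixed∣+∣∁B∩fixed∣≤∣∁B∣ : ∣ ∁ B ∩ fixedPoints α ∣ + ∣ ∁ B ∩ fixedPoints α ∣ ≤ ∣ ∁ B ∣
        ∣∁B∩fixed∣+∣∁B∩fixed∣≤∣∁B∣ with any? (λ z → (z ∈? B) ×-dec ¬? (fixed? α z))
        ... | yes (z , z∈B , αz≢z) = moved∈B⇒∣∁B∩fixed∣+∣∁B∩fixed∣≤∣∁B∣ z∈B αz≢z
        ... | no ¬moved∈B =
          subst (λ k → k + k ≤ ∣ ∁ B ∣) (sym (fixes-B⇒∣∁B∩fixed∣≡0 fixes-B)) z≤n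
          where
          fixes-B : ∀ {b} → b ∈ B → α b ≡ b
          fixes-B {b} b∈B = decidable-stable (fixed? α b) (λ αb≢b → ¬moved∈B (b , b∈B , αb≢b))

n^8≡[n*n]^4 : ∀ n → n ^ 8 ≡ (n * n) ^ 4
n^8≡[n*n]^4 n = trans (sym (^-*-assoc n 2 4)) (cong (λ k → (n * k) ^ 4) (*-identityʳ n))

exponent-bound : ∀ m f → f + f ≤ m → (m + f) * 4 ≤ 3 * (2 * m)
exponent-bound m f f+f≤m = begin
  (m + f) * 4          ≡⟨ regroup m f ⟩
  m * 4 + (f + f) * 2  ≤⟨ +-monoʳ-≤ (m * 4) (*-monoˡ-≤ 2 f+f≤m) ⟩
  m * 4 + m * 2        ≡⟨ collect m ⟩
  3 * (2 * m)          ∎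
  where
  open ≤-Reasoning
  regroup : ∀ m f → (m + f) * 4 ≡ m * 4 + (f + f) * 2
  regroup = solve-∀
  collect : ∀ m → m * 4 + m * 2 ≡ 3 * (2 * m)
  collect = solve-∀

lemma3p2 : (G : FiniteGroup) (B : Subset (FiniteGroup.order G)) (α : Fin (FiniteGroup.order G) → Fin (FiniteGroup.order G)) →
    IsSubgroup G B → HasIndex2 G B → IsAutomorphism G α → NonIdentity G α →
    ImageInvariant α B →
    countGood B α ^ 8 ≤ 2 ^ (3 * FiniteGroup.order G)
lemma3p2 G B α B-subgroup B-index2 α-automorphism α-nonIdentity _ = begin
  N ^ 8                  ≡⟨ n^8≡[n*n]^4 N ⟩
  (N * N) ^ 4            ≤⟨ ^-monoˡ-≤ 4 (countGood*countGood≤ B (proj₁ bijective)) ⟩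
  (2 ^ m * 2 ^ f) ^ 4    ≡⟨ cong (_^ 4) (^-distribˡ-+-* 2 m f) ⟨
  (2 ^ (m + f)) ^ 4      ≡⟨ ^-*-assoc 2 (m + f) 4 ⟩
  2 ^ ((m + f) * 4)      ≤⟨ ^-monoʳ-≤ 2 (exponent-bound m f f+f≤m) ⟩
  2 ^ (3 * (2 * m))      ≡⟨ cong (λ k → 2 ^ (3 * k)) order≡2m ⟨
  2 ^ (3 * order)        ∎
  where
  open ≤-Reasoning
  open FiniteGroup G using (order)
  open IsAutomorphism α-automorphism
  N = countGood B α
  m = ∣ ∁ B ∣
  f = ∣ ∁ B ∩ fixedPoints α ∣
  f+f≤m : f + f ≤ m
  f+f≤m = ∣∁B∩fixed∣+∣∁B∩fixed∣≤∣∁B∣ G homo B-subgroup B-index2 α-nonIdentity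
  order≡2m : order ≡ 2 * m
  order≡2m = trans B-index2 (cong (2 *_) (sym (∣∁B∣≡∣B∣ G B-subgroup B-index2)))
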